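{- Let $\mathcal{G}$ be a graph class containing $K_2$ with $\mathrm{mad}(G)\le d$ for all $G\in\mathcal{G}$, and let $H$ be a graph. If there is a constant $s$ such that $c^{\mathcal{G}}_{\mathrm f}(H')\le s$ for every induced subgraph $H'$ of $H$, then $\mathrm{mad}(H)\le sd$.
   Context: All graphs are finite and simple. $\mathrm{mad}(G)=\max\{2|E(G')|/|V(G')| : G'\subseteq G,\ |V(G')|>0\}$. For graphs $G,H$, a homomorphism $\varphi\colon G\to H$ is a map $V(G)\to V(H)$ with $\varphi(u)\varphi(v)\in E(H)$ whenever $uv\in E(G)$. $\dot\cup$ denotes vertex-disjoint union. For a graph class $\mathcal{G}$ and a graph $H$, a $\mathcal{G}$-cover of $H$ is an edge-surjective homomorphism $\varphi\colon G_1\dot\cup\cdots\dot\cup G_t\to H$ with all $G_i\in\mathcal{G}$; it is $s$-local if $|\varphi^{ -1}(v)|\le s$ for all $v\in V(H)$. $c^{\mathcal{G}}_{\mathrm f}(H)$ is the least $s$ such that $H$ has an $s$-local (not necessarily injective) $\mathcal{G}$-cover.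
   Formalization: The bound d on the maximum average degree of the graphs in 𝒢 is rational. -}

module Defs where

open import Data.Bool using (Bool; true; false)
open import Data.Nat using (ℕ; zero; suc; _+_; _*_; _<_; _≤_; NonZero; >-nonZero)
open import Data.Nat.Properties using (_<?_)
open import Data.Fin using (Fin; toℕ) renaming (zero to fzero; suc to fsuc)
open import Data.Fin.Properties using () renaming (_≟_ to _≟ᶠ_)
open import Data.Integer using (+_)
open import Data.Rational using (ℚ; _/_) renaming (_≤_ to _≤ℚ_; _*_ to _*ℚ_)
open import Data.List using (List; length; filter; allFin; concatMap; map)
open import Data.Nat.ListAction using (sum)
open import Data.Product using (Σ; _×_; _,_; proj₁; proj₂; ∃-syntax)
open import Relation.Binary.PropositionalEquality using (_≡_; _≢_)
open import Relation.Nullary using (¬_)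
open import Relation.Nullary.Decidable using (_×-dec_)
open import Data.Bool.Properties using () renaming (_≟_ to _≟ᵇ_)
open import Function.Definitions using (Injective)

record Graph : Set where
  field
    V     : ℕ
    adj   : Fin V → Fin V → Bool
    sym   : ∀ u v → adj u v ≡ adj v u
    irrefl : ∀ v → adj v v ≡ false
open Graph public

edgeCount : Graph → ℕ
edgeCount G = length (filter (λ p → (toℕ (proj₁ p) <? toℕ (proj₂ p)) ×-dec (adj G (proj₁ p) (proj₂ p) ≟ᵇ true))
                             (concatMap (λ u → map (λ v → (u , v)) (allFin (V G))) (allFin (V G))))

IsHom : (G H : Graph) → (Fin (V G) → Fin (V H)) → Set
IsHom G H f = ∀ u v → adj G u v ≡ true → adj H (f u) (f v) ≡ true

-- G' is (isomorphic to) a subgraph of G: an injective homomorphism G' → G.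
_⊆G_ : Graph → Graph → Set
G' ⊆G G = Σ (Fin (V G') → Fin (V G)) λ f → IsHom G' G f × Injective _≡_ _≡_ f

-- H' is (isomorphic to) an induced subgraph of H: an injective homomorphism
-- that also reflects adjacency.
_⊆ind_ : Graph → Graph → Set
H' ⊆ind H = Σ (Fin (V H') → Fin (V H)) λ f →
              IsHom H' H f × Injective _≡_ _≡_ f × (∀ u v → adj H (f u) (f v) ≡ true → adj H' u v ≡ true)

madLe : Graph → ℚ → Set
madLe G d = ∀ (G' : Graph) → G' ⊆G G → (p : 0 < V G') →
            ((+ (2 * edgeCount G')) / V G') {{>-nonZero p}} ≤ℚ d

K₂ : Graph
K₂ = record { V = 2 ; adj = a ; sym = s ; irrefl = i }
  where
  a : Fin 2 → Fin 2 → Bool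
  a fzero fzero = false
  a fzero (fsuc fzero) = true
  a (fsuc fzero) fzero = true
  a (fsuc fzero) (fsuc fzero) = false
  s : ∀ u v → a u v ≡ a v u
  s fzero fzero = _≡_.refl
  s fzero (fsuc fzero) = _≡_.refl
  s (fsuc fzero) fzero = _≡_.refl
  s (fsuc fzero) (fsuc fzero) = _≡_.refl
  i : ∀ v → a v v ≡ false
  i fzero = _≡_.refl
  i (fsuc fzero) = _≡_.refl

GraphClass : Set₁
GraphClass = Graph → Set

-- A 𝒢-cover of H: graphs G_1,…,G_t ∈ 𝒢 (indexed by Fin t) and a homomorphism
-- φ from their disjoint union (given componentwise) to H, surjective on edges.
record Cover (𝒢 : GraphClass) (H : Graph) : Set where
  field
    t      : ℕ
    comp   : Fin t → Graph
    inClass : ∀ i → 𝒢 (comp i)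
    φ      : (i : Fin t) → Fin (V (comp i)) → Fin (V H)
    hom    : ∀ i → IsHom (comp i) H (φ i)
    edgeSurj : ∀ u v → adj H u v ≡ true →
               Σ (Fin t) λ i → Σ (Fin (V (comp i))) λ x → Σ (Fin (V (comp i))) λ y →
                 (adj (comp i) x y ≡ true) × (φ i x ≡ u) × (φ i y ≡ v)
open Cover public

preimageSize : ∀ {𝒢 H} → Cover 𝒢 H → Fin (V H) → ℕ
preimageSize c v =
  sum (map (λ i → length (filter (λ x → φ c i x ≟ᶠ v) (allFin (V (comp c i))))) (allFin (t c)))

IsLocal : ∀ {𝒢 H} → ℕ → Cover 𝒢 H → Set
IsLocal s c = ∀ v → preimageSize c v ≤ s

-- c_f^𝒢(H) ≤ s  ⟺  H has an s-local 𝒢-cover (c_f is the least such s; the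
-- property is monotone in s).
cfLe : GraphClass → Graph → ℕ → Set
cfLe 𝒢 H s = Σ (Cover 𝒢 H) λ c → IsLocal s c

module Submission where

-- Since K₂ ∈ 𝒢 we have d ≥ mad(K₂) = 1, so d = p/q with p, q natural. Let G' ⊆ H and
-- let H' be the subgraph of H induced on the image of G'; then |E(G')| ≤ |E(H')|. Take an
-- s-local 𝒢-cover φ : G₁ ∪ ⋯ ∪ G_t → H'. Edge-surjectivity gives |E(H')| ≤ Σ |E(G_i)|,
-- each 2|E(G_i)| ≤ d |V(G_i)|, and Σ |V(G_i)| = Σ_v |φ⁻¹(v)| ≤ s |V(H')| = s |V(G')|;
-- multiplying the last bound by d ≥ 0 gives 2|E(G')| ≤ s d |V(G')|.

open import Defs
open import Data.Fin using (Fin; zero; suc; toℕ)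
open import Data.Nat using (ℕ; zero; suc; _+_; _≤_; _<_; z≤n; s≤s; NonZero; >-nonZero)
open import Data.Product using (∃₂; _×_; _,_; proj₁; proj₂)
open import Function.Definitions using (Injective)
open import Level using (Level; 0ℓ)
open import Relation.Binary.PropositionalEquality as ≡ using (_≡_; refl; trans; cong; cong₂; subst₂; module ≡-Reasoning)

module Counting where

  open import Data.Nat.Properties using (+-*-semiring)
  open import Algebra.Properties.Semiring.Sum +-*-semiring
    using (sum; sum-syntax; ∑-comm; ∑-distrib-+; sum-cong-≗; sum-replicate-zero; *-distribˡ-sum; *-distribʳ-sum)
  open import Data.Bool using (true; false; if_then_else_)
  open import Data.Bool.Properties using () renaming (_≟_ to _≟ᵇ_)
  open import Data.Fin.Properties using (_≟_; toℕ-injective)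
  open import Data.List using (List; []; _∷_; _++_; length; filter; map; concatMap; allFin; tabulate; cartesianProduct)
  open import Data.List.Properties using (length-++; length-map; length-tabulate; map-tabulate; map-cong)
  open import Data.List.Membership.Propositional using (_∈_; lose)
  open import Data.List.Membership.Propositional.Properties
    using (∈-allFin; ∈-map⁺; ∈-concatMap⁺; ∈-filter⁺; ∈-filter⁻; ∈-cartesianProduct⁺; ∈-∃++; ∈-++⁻; ∈-++⁺ˡ; ∈-++⁺ʳ)
  open import Data.List.Relation.Binary.Permutation.Propositional.Properties using (shift; ↭-length)
  open import Data.List.Relation.Binary.Subset.Propositional using (_⊆_)
  open import Data.List.Relation.Binary.Sublist.Propositional using (⊆-refl)
  open import Data.List.Relation.Binary.Sublist.Propositional.Properties using (length-mono-≤)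
    renaming (filter⁺ to filter⁺-sublist)
  import Data.List.Relation.Unary.All as All
  open import Data.List.Relation.Unary.AllPairs using (_∷_)
  open import Data.List.Relation.Unary.Any using (here; there)
  open import Data.List.Relation.Unary.Unique.Propositional using (Unique)
  open import Data.List.Relation.Unary.Unique.Propositional.Properties using (filter⁺; cartesianProduct⁺; allFin⁺)
  open import Data.Nat using (_*_)
  open import Data.Nat.Properties
    using (_<?_; <-cmp; <-irrefl; <-trans; <⇒≢; ≤-reflexive; ≤-trans; +-mono-≤; *-monoˡ-≤; *-monoʳ-≤; *-comm; *-assoc; module ≤-Reasoning)
  import Data.Nat.ListAction as List
  open import Data.Sum using (inj₁; inj₂)
  open import Function using (_∘_)
  open import Relation.Binary.Definitions using (tri<; tri≈; tri>)
  open import Relation.Nullary using (Dec; yes; no; does; contradiction)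
  open import Relation.Nullary.Decidable using (_×-dec_)
  open import Relation.Unary using (Pred; Decidable)

  private
    variable
      ℓ : Level
      A B : Set ℓ

  ∑-mono-≤ : ∀ {n} {f g : Fin n → ℕ} → (∀ i → f i ≤ g i) → sum f ≤ sum g
  ∑-mono-≤ {zero}  f≤g = z≤n
  ∑-mono-≤ {suc n} f≤g = +-mono-≤ (f≤g zero) (∑-mono-≤ (f≤g ∘ suc))

  ∑-const : ∀ n c → ∑[ i < n ] c ≡ n * c
  ∑-const zero    c = refl
  ∑-const (suc n) c = cong (c +_) (∑-const n c)

  sum-tabulate : ∀ {n} (f : Fin n → ℕ) → List.sum (tabulate f) ≡ sum f
  sum-tabulate {zero}  f = refl
  sum-tabulate {suc n} f = cong (f zero +_) (sum-tabulate (f ∘ suc))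

  sum-map-allFin : ∀ {n} (f : Fin n → ℕ) → List.sum (map f (allFin n)) ≡ sum f
  sum-map-allFin f = trans (cong List.sum (map-tabulate (λ i → i) f)) (sum-tabulate f)

  length-concatMap : (f : A → List B) (xs : List A) → length (concatMap f xs) ≡ List.sum (map (length ∘ f) xs)
  length-concatMap f []       = refl
  length-concatMap f (x ∷ xs) = trans (length-++ (f x)) (cong (length (f x) +_) (length-concatMap f xs))

  indicator : ∀ {P : Set ℓ} → Dec P → ℕ
  indicator P? = if does P? then 1 else 0

  length-filter-∷ : ∀ {P : Pred A ℓ} (P? : Decidable P) x xs →
                    length (filter P? (x ∷ xs)) ≡ indicator (P? x) + length (filter P? xs)
  length-filter-∷ P? x xs with does (P? x)
  ... | true  = refl
  ... | false = refl

  ∑-indicator-≟ : ∀ {n} (w : Fin n) → ∑[ v < n ] indicator (w ≟ v) ≡ 1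
  ∑-indicator-≟ {suc n} zero    = cong suc (sum-replicate-zero n)
  ∑-indicator-≟ {suc n} (suc w) = ∑-indicator-≟ w

  ∑-fibre-sizes : ∀ {n} (g : A → Fin n) xs → ∑[ v < n ] length (filter (λ x → g x ≟ v) xs) ≡ length xs
  ∑-fibre-sizes {n = n} g []       = sum-replicate-zero n
  ∑-fibre-sizes {n = n} g (x ∷ xs) = begin
    ∑[ v < n ] length (filter (λ y → g y ≟ v) (x ∷ xs))
      ≡⟨ sum-cong-≗ (λ v → length-filter-∷ (λ y → g y ≟ v) x xs) ⟩
    ∑[ v < n ] (indicator (g x ≟ v) + length (filter (λ y → g y ≟ v) xs))
      ≡⟨ ∑-distrib-+ (λ v → indicator (g x ≟ v)) (λ v → length (filter (λ y → g y ≟ v) xs)) ⟩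
    ∑[ v < n ] indicator (g x ≟ v) + ∑[ v < n ] length (filter (λ y → g y ≟ v) xs)
      ≡⟨ cong₂ _+_ (∑-indicator-≟ (g x)) (∑-fibre-sizes g xs) ⟩
    suc (length xs) ∎
    where open ≡-Reasoning

  Unique-⊆⇒length-≤ : ∀ {xs ys : List A} → Unique xs → xs ⊆ ys → length xs ≤ length ys
  Unique-⊆⇒length-≤ {xs = []}     _              _     = z≤n
  Unique-⊆⇒length-≤ {xs = x ∷ xs} (x∉xs ∷ xs-uniq) x∷xs⊆ys with ∈-∃++ (x∷xs⊆ys (here refl))
  ... | as , bs , refl = begin
    suc (length xs)         ≤⟨ s≤s (Unique-⊆⇒length-≤ xs-uniq xs⊆as++bs) ⟩
    suc (length (as ++ bs)) ≡⟨ ↭-length (shift x as bs) ⟨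
    length (as ++ x ∷ bs)   ∎
    where
    open ≤-Reasoning
    xs⊆as++bs : xs ⊆ as ++ bs
    xs⊆as++bs z∈xs with ∈-++⁻ as (x∷xs⊆ys (there z∈xs))
    ... | inj₁ z∈as          = ∈-++⁺ˡ z∈as
    ... | inj₂ (here refl)   = contradiction refl (All.lookup x∉xs z∈xs)
    ... | inj₂ (there z∈bs) = ∈-++⁺ʳ as z∈bs

  vertexPairs : ∀ n → List (Fin n × Fin n)
  vertexPairs n = concatMap (λ u → map (λ v → (u , v)) (allFin n)) (allFin n)

  concatMap-map-,≡cartesianProduct : (xs : List A) (ys : List B) →
                                     concatMap (λ x → map (λ y → (x , y)) ys) xs ≡ cartesianProduct xs ys
  concatMap-map-,≡cartesianProduct []       ys = refl
  concatMap-map-,≡cartesianProduct (x ∷ xs) ys = cong (map (x ,_) ys ++_) (concatMap-map-,≡cartesianProduct xs ys)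

  vertexPairs-unique : ∀ n → Unique (vertexPairs n)
  vertexPairs-unique n rewrite concatMap-map-,≡cartesianProduct (allFin n) (allFin n) =
    cartesianProduct⁺ (allFin⁺ n) (allFin⁺ n)

  ∈-vertexPairs : ∀ {n} (u v : Fin n) → (u , v) ∈ vertexPairs n
  ∈-vertexPairs {n} u v rewrite concatMap-map-,≡cartesianProduct (allFin n) (allFin n) =
    ∈-cartesianProduct⁺ (∈-allFin u) (∈-allFin v)

  IsOrientedEdge : (G : Graph) → Pred (Fin (V G) × Fin (V G)) 0ℓ
  IsOrientedEdge G (u , v) = toℕ u < toℕ v × adj G u v ≡ true

  isOrientedEdge? : (G : Graph) → Decidable (IsOrientedEdge G)
  isOrientedEdge? G p = (toℕ (proj₁ p) <? toℕ (proj₂ p)) ×-dec (adj G (proj₁ p) (proj₂ p) ≟ᵇ true)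

  -- Chosen so that edgeCount G reduces to length (edges G).
  edges : (G : Graph) → List (Fin (V G) × Fin (V G))
  edges G = filter (isOrientedEdge? G) (vertexPairs (V G))

  edges-unique : ∀ G → Unique (edges G)
  edges-unique G = filter⁺ (isOrientedEdge? G) (vertexPairs-unique (V G))

  ∈-edges⁺ : ∀ {G u v} → toℕ u < toℕ v → adj G u v ≡ true → (u , v) ∈ edges G
  ∈-edges⁺ {G} {u} {v} u<v uv = ∈-filter⁺ (isOrientedEdge? G) (∈-vertexPairs u v) (u<v , uv)

  ∈-edges⁻ : ∀ {G u v} → (u , v) ∈ edges G → IsOrientedEdge G (u , v)
  ∈-edges⁻ {G} uv∈ = proj₂ (∈-filter⁻ (isOrientedEdge? G) {xs = vertexPairs (V G)} uv∈)

  ⊆G-refl : ∀ {G} → G ⊆G G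
  ⊆G-refl = (λ u → u) , (λ _ _ uv → uv) , (λ u≡v → u≡v)

  pullback : (H : Graph) {n : ℕ} → (Fin n → Fin (V H)) → Graph
  pullback H {n} f = record
    { V      = n
    ; adj    = λ u v → adj H (f u) (f v)
    ; sym    = λ u v → sym H (f u) (f v)
    ; irrefl = λ v → irrefl H (f v)
    }

  pullback-⊆ind : ∀ {H n} {f : Fin n → Fin (V H)} → Injective _≡_ _≡_ f → pullback H f ⊆ind H
  pullback-⊆ind {f = f} f-inj = f , (λ _ _ uv → uv) , f-inj , (λ _ _ uv → uv)

  edgeCount-≤-pullback : ∀ {G H} {f : Fin (V G) → Fin (V H)} → IsHom G H f → edgeCount G ≤ edgeCount (pullback H f)
  edgeCount-≤-pullback {G} {H} {f} f-hom =
    length-mono-≤ (filter⁺-sublist (isOrientedEdge? G) (isOrientedEdge? (pullback H f))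
                                    (λ { refl (u<v , uv) → u<v , f-hom _ _ uv }) (⊆-refl {x = vertexPairs (V G)}))

  orient : ∀ {n} → Fin n × Fin n → Fin n × Fin n
  orient (u , v) with toℕ u <? toℕ v
  ... | yes _ = (u , v)
  ... | no _  = (v , u)

  orient-< : ∀ {n} {u v : Fin n} → toℕ u < toℕ v → orient (u , v) ≡ (u , v)
  orient-< {u = u} {v} u<v with toℕ u <? toℕ v
  ... | yes _   = refl
  ... | no u≮v = contradiction u<v u≮v

  orient-> : ∀ {n} {u v : Fin n} → toℕ u < toℕ v → orient (v , u) ≡ (u , v)
  orient-> {u = u} {v} u<v with toℕ v <? toℕ u
  ... | yes v<u = contradiction (<-trans u<v v<u) (<-irrefl refl)
  ... | no _    = refl

  -- 2|E(G)|/|V(G)| ≤ p/q with denominators cleared; it also makes sense for the empty graph.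
  record Density≤ (p q : ℕ) (G : Graph) : Set where
    constructor density≤
    field
      2∣E∣*q≤p*∣V∣ : 2 * edgeCount G * q ≤ p * V G

  Density≤-pullback : ∀ {G H p q} {f : Fin (V G) → Fin (V H)} → IsHom G H f →
                      Density≤ p q (pullback H f) → Density≤ p q G
  Density≤-pullback {G} {H} {q = q} {f} f-hom (density≤ bound) =
    density≤ (≤-trans (*-monoˡ-≤ q (*-monoʳ-≤ 2 (edgeCount-≤-pullback {G} {H} {f} f-hom))) bound)

  module _ {𝒢 : GraphClass} {H : Graph} (c : Cover 𝒢 H) where

    imageEdge : ∀ i → Fin (V (comp c i)) × Fin (V (comp c i)) → Fin (V H) × Fin (V H)
    imageEdge i (x , y) = orient (φ c i x , φ c i y)

    edgeImage : List (Fin (V H) × Fin (V H))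
    edgeImage = concatMap (λ i → map (imageEdge i) (edges (comp c i))) (allFin (t c))

    ∈-edgeImage : ∀ i {x y} → (x , y) ∈ edges (comp c i) → imageEdge i (x , y) ∈ edgeImage
    ∈-edgeImage i xy∈ = ∈-concatMap⁺ (λ j → map (imageEdge j) (edges (comp c j)))
                                     (lose (∈-allFin i) (∈-map⁺ (imageEdge i) xy∈))

    edges-⊆-edgeImage : edges H ⊆ edgeImage
    edges-⊆-edgeImage {u , v} uv∈ with ∈-edges⁻ {H} uv∈
    ... | u<v , uv with edgeSurj c u v uv
    ... | i , x , y , xy , refl , refl with <-cmp (toℕ x) (toℕ y)
    ... | tri< x<y _ _ = ≡.subst (_∈ edgeImage) (orient-< u<v) (∈-edgeImage i (∈-edges⁺ {comp c i} x<y xy))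
    ... | tri≈ _ x≡y _ = contradiction (cong (toℕ ∘ φ c i) (toℕ-injective x≡y)) (<⇒≢ u<v)
    ... | tri> _ _ y<x = ≡.subst (_∈ edgeImage) (orient-> u<v)
                           (∈-edgeImage i (∈-edges⁺ {comp c i} y<x (trans (sym (comp c i) y x) xy)))

    length-edgeImage : length edgeImage ≡ ∑[ i < t c ] edgeCount (comp c i)
    length-edgeImage = begin
      length edgeImage
        ≡⟨ length-concatMap (λ i → map (imageEdge i) (edges (comp c i))) (allFin (t c)) ⟩
      List.sum (map (λ i → length (map (imageEdge i) (edges (comp c i)))) (allFin (t c)))
        ≡⟨ cong List.sum (map-cong (λ i → length-map (imageEdge i) (edges (comp c i))) (allFin (t c))) ⟩
      List.sum (map (λ i → edgeCount (comp c i)) (allFin (t c)))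
        ≡⟨ sum-map-allFin (λ i → edgeCount (comp c i)) ⟩
      ∑[ i < t c ] edgeCount (comp c i) ∎
      where open ≡-Reasoning

    edgeCount-≤-∑-edgeCount : edgeCount H ≤ ∑[ i < t c ] edgeCount (comp c i)
    edgeCount-≤-∑-edgeCount =
      ≤-trans (Unique-⊆⇒length-≤ (edges-unique H) edges-⊆-edgeImage) (≤-reflexive length-edgeImage)

    ∑-preimageSize : ∑[ v < V H ] preimageSize c v ≡ ∑[ i < t c ] V (comp c i)
    ∑-preimageSize = begin
      ∑[ v < V H ] preimageSize c v          ≡⟨ sum-cong-≗ (λ v → sum-map-allFin (λ i → fibre i v)) ⟩
      ∑[ v < V H ] ∑[ i < t c ] fibre i v    ≡⟨ ∑-comm (λ v i → fibre i v) ⟩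
      ∑[ i < t c ] ∑[ v < V H ] fibre i v    ≡⟨ sum-cong-≗ (λ i → ∑-fibre-sizes (φ c i) (allFin (V (comp c i)))) ⟩
      ∑[ i < t c ] length (allFin (V (comp c i))) ≡⟨ sum-cong-≗ {t c} (λ i → length-tabulate (λ x → x)) ⟩
      ∑[ i < t c ] V (comp c i)              ∎
      where
      open ≡-Reasoning
      fibre : ∀ i → Fin (V H) → ℕ
      fibre i v = length (filter (λ x → φ c i x ≟ v) (allFin (V (comp c i))))

    ∑V≤s*V : ∀ {s} → IsLocal s c → ∑[ i < t c ] V (comp c i) ≤ s * V H
    ∑V≤s*V {s} local = begin
      ∑[ i < t c ] V (comp c i)   ≡⟨ ∑-preimageSize ⟨
      ∑[ v < V H ] preimageSize c v ≤⟨ ∑-mono-≤ local ⟩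
      ∑[ v < V H ] s              ≡⟨ ∑-const (V H) s ⟩
      V H * s                     ≡⟨ *-comm (V H) s ⟩
      s * V H                     ∎
      where open ≤-Reasoning

    Density≤-local-cover : ∀ {p q s} → (∀ i → Density≤ p q (comp c i)) → IsLocal s c → Density≤ (s * p) q H
    Density≤-local-cover {p} {q} {s} dense local = density≤ (begin
      2 * edgeCount H * q                    ≤⟨ *-monoˡ-≤ q (*-monoʳ-≤ 2 edgeCount-≤-∑-edgeCount) ⟩
      2 * ∑[ i < t c ] e i * q               ≡⟨ cong (_* q) (*-distribˡ-sum 2 e) ⟩
      ∑[ i < t c ] (2 * e i) * q             ≡⟨ *-distribʳ-sum q (λ i → 2 * e i) ⟩
      ∑[ i < t c ] (2 * e i * q)             ≤⟨ ∑-mono-≤ (Density≤.2∣E∣*q≤p*∣V∣ ∘ dense) ⟩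
      ∑[ i < t c ] (p * v i)                 ≡⟨ *-distribˡ-sum p v ⟨
      p * ∑[ i < t c ] v i                   ≤⟨ *-monoʳ-≤ p (∑V≤s*V local) ⟩
      p * (s * V H)                          ≡⟨ *-assoc p s (V H) ⟨
      p * s * V H                            ≡⟨ cong (_* V H) (*-comm p s) ⟩
      s * p * V H                            ∎)
      where
      open ≤-Reasoning
      e v : Fin (t c) → ℕ
      e i = edgeCount (comp c i)
      v i = V (comp c i)

module Fractions where

  open Counting using (⊆G-refl; Density≤; density≤)
  open import Data.Integer as ℤ using (+_; -[1+_])
  import Data.Integer.Properties as ℤ
  open import Data.Nat using (_*_)
  open import Data.Nat.Properties using (*-identityˡ)
  open import Data.Rational as ℚ using (mkℚ; 0ℚ; _/_; toℚᵘ; *≤*)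
  import Data.Rational.Properties as ℚ
  import Data.Rational.Unnormalised as ℚᵘ
  import Data.Rational.Unnormalised.Properties as ℚᵘ
  open import Function using (_⇔_; mk⇔; Equivalence)

  toℚᵘ-/ : ∀ i n .{{_ : NonZero n}} → toℚᵘ (i / n) ℚᵘ.≃ i ℚᵘ./ n
  toℚᵘ-/ i (suc n) = ℚ.toℚᵘ-fromℚᵘ (ℚᵘ.mkℚᵘ i n)

  +/ᵘ-≤-+/ᵘ⇔ : ∀ a b m n .{{_ : NonZero m}} .{{_ : NonZero n}} → (+ a ℚᵘ./ m ℚᵘ.≤ + b ℚᵘ./ n) ⇔ (a * n ≤ b * m)
  +/ᵘ-≤-+/ᵘ⇔ a b m@(suc _) n@(suc _) = mk⇔
    (λ { (ℚᵘ.*≤* an≤bm) → ℤ.drop‿+≤+ (subst₂ ℤ._≤_ (≡.sym (ℤ.pos-* a n)) (≡.sym (ℤ.pos-* b m)) an≤bm) })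
    (λ an≤bm → ℚᵘ.*≤* (subst₂ ℤ._≤_ (ℤ.pos-* a n) (ℤ.pos-* b m) (ℤ.+≤+ an≤bm)))

  +/-≤-+/⇔ : ∀ a b m n .{{_ : NonZero m}} .{{_ : NonZero n}} → (+ a / m ℚ.≤ + b / n) ⇔ (a * n ≤ b * m)
  +/-≤-+/⇔ a b m n = mk⇔
    (λ a/m≤b/n → Equivalence.to (+/ᵘ-≤-+/ᵘ⇔ a b m n)
      (ℚᵘ.≤-respʳ-≃ (toℚᵘ-/ (+ b) n) (ℚᵘ.≤-respˡ-≃ (toℚᵘ-/ (+ a) m) (ℚ.toℚᵘ-mono-≤ a/m≤b/n))))
    (λ an≤bm → ℚ.toℚᵘ-cancel-≤
      (ℚᵘ.≤-respʳ-≃ (ℚᵘ.≃-sym (toℚᵘ-/ (+ b) n)) (ℚᵘ.≤-respˡ-≃ (ℚᵘ.≃-sym (toℚᵘ-/ (+ a) m))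
        (Equivalence.from (+/ᵘ-≤-+/ᵘ⇔ a b m n) an≤bm))))

  +/1*+/ : ∀ s p n .{{_ : NonZero n}} → (+ s / 1) ℚ.* (+ p / n) ≡ + (s * p) / n
  +/1*+/ s p n@(suc _) = ℚ.toℚᵘ-injective (begin
    toℚᵘ ((+ s / 1) ℚ.* (+ p / n))          ≈⟨ ℚ.toℚᵘ-homo-* (+ s / 1) (+ p / n) ⟩
    toℚᵘ (+ s / 1) ℚᵘ.* toℚᵘ (+ p / n)      ≈⟨ ℚᵘ.*-cong (toℚᵘ-/ (+ s) 1) (toℚᵘ-/ (+ p) n) ⟩
    (+ s ℚᵘ./ 1) ℚᵘ.* (+ p ℚᵘ./ n)          ≡⟨ ℚᵘ./-cong (≡.sym (ℤ.pos-* s p)) (*-identityˡ n) ⟩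
    + (s * p) ℚᵘ./ n                        ≈⟨ toℚᵘ-/ (+ (s * p)) n ⟨
    toℚᵘ (+ (s * p) / n)                    ∎)
    where open ℚᵘ.≃-Reasoning

  0≤⇒≡+/ : ∀ d → 0ℚ ℚ.≤ d → ∃₂ λ p n → d ≡ + p / suc n
  0≤⇒≡+/ d@(mkℚ (+ p) n _)     _         = p , n , ≡.sym (ℚ.↥p/↧p≡p d)
  0≤⇒≡+/ (mkℚ -[1+ _ ] _ _) (*≤* ())

  madLe-K₂⇒0≤ : ∀ {d} → madLe K₂ d → 0ℚ ℚ.≤ d
  madLe-K₂⇒0≤ mad = ℚ.≤-trans (*≤* (ℤ.+≤+ z≤n)) (mad K₂ (⊆G-refl {K₂}) (s≤s z≤n))

  madLe⇒Density≤ : ∀ {G} p n .{{_ : NonZero n}} → madLe G (+ p / n) → Density≤ p n G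
  madLe⇒Density≤ {record { V = zero }}    p n mad = density≤ z≤n
  madLe⇒Density≤ {G@record { V = suc _ }} p n mad = density≤ (
    Equivalence.to (+/-≤-+/⇔ (2 * edgeCount G) p (V G) n) (mad G (⊆G-refl {G}) (s≤s z≤n)))

  Density≤⇒/≤+/1*+/ : ∀ {G} s p n .{{_ : NonZero n}} (0<V : 0 < V G) → Density≤ (s * p) n G →
                      (+ (2 * edgeCount G) / V G) {{>-nonZero 0<V}} ℚ.≤ (+ s / 1) ℚ.* (+ p / n)
  Density≤⇒/≤+/1*+/ {G} s p n 0<V (density≤ dense) = ℚ.≤-trans
    (Equivalence.from (+/-≤-+/⇔ (2 * edgeCount G) (s * p) (V G) n {{>-nonZero 0<V}}) dense)
    (ℚ.≤-reflexive (≡.sym (+/1*+/ s p n)))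

-- Natural-number multiplication is only opened inside the two modules above, so that
-- _*_ below is the multiplication of rationals used in the statement.
open Counting using (Density≤; pullback; pullback-⊆ind; Density≤-pullback; Density≤-local-cover)
open Fractions using (0≤⇒≡+/; madLe-K₂⇒0≤; madLe⇒Density≤; Density≤⇒/≤+/1*+/)
open import Data.Integer using (+_)
open import Data.Rational using (ℚ; _/_; _*_)

lemma12 : (𝒢 : GraphClass) (d : ℚ) (H : Graph) (s : ℕ) →
    𝒢 K₂ →
    (∀ G → 𝒢 G → madLe G d) →
    (∀ H' → H' ⊆ind H → cfLe 𝒢 H' s) →
    madLe H ((+ s / 1) * d)
lemma12 𝒢 d H s K₂∈𝒢 mad𝒢 cover𝒢 G' (f , f-hom , f-inj) 0<V
  with 0≤⇒≡+/ d (madLe-K₂⇒0≤ (mad𝒢 K₂ K₂∈𝒢))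
... | p , k , refl =
  Density≤⇒/≤+/1*+/ s p (suc k) 0<V (Density≤-pullback {G'} {H} f-hom (Density≤-local-cover c dense local))
  where
  c : Cover 𝒢 (pullback H f)
  c = proj₁ (cover𝒢 (pullback H f) (pullback-⊆ind {H} f-inj))

  local : IsLocal s c
  local = proj₂ (cover𝒢 (pullback H f) (pullback-⊆ind {H} f-inj))

  dense : ∀ i → Density≤ p (suc k) (comp c i)
  dense i = madLe⇒Density≤ p (suc k) (mad𝒢 (comp c i) (inClass c i))
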